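{- The relation $\leq_{[\mathrm{c}]}$ on the set of $\sim_{\mathrm{c}}$-equivalence classes of $S_n$ satisfies: (i) $\leq_{[\mathrm{c}]}$ is a partial order on the $\sim_{\mathrm{c}}$-equivalence classes of $S_n$; and (ii) if $[\tau] \leq_{[\mathrm{c}]} [\sigma]$, then for each $\tau' \in [\tau]$ there exists some $\sigma' \in [\sigma]$ such that $\tau' \leq_{\mathrm{c}} \sigma'$.
   Context: For $\sigma \in S_n$ and $\ell \ge 2$, $C_\ell(\sigma)$ denotes the set of $\ell$-cycles of $\sigma$; the cycle inclusion order is $\tau \leq_{\mathrm{c}} \sigma$ iff $C_k(\tau) \subseteq C_k(\sigma)$ for all $k \ge 2$. The equivalence relation $\sim_{\mathrm{c}}$ on $S_n$: $\sigma \sim_{\mathrm{c}} \tau$ if each cycle of $\sigma$ (fixed points included as 1-cycles) is either equal to, or the inverse of, a cycle of $\tau$, and vice versa; $[\sigma]$ denotes the $\sim_{\mathrm{c}}$-class of $\sigma$. Define $[\tau] \leq_{[\mathrm{c}]} [\sigma]$ if there exist $\tau' \in [\tau]$ and $\sigma' \in [\sigma]$ with $\tau' \leq_{\mathrm{c}} \sigma'$. -}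

module Defs where

open import Data.Nat using (ℕ; zero; suc; _≤_; _<_)
open import Data.Fin using (Fin)
open import Data.Fin.Permutation using (Permutation′; _⟨$⟩ʳ_)
open import Data.Maybe using (Maybe; just; nothing)
open import Data.Product using (Σ; ∃; ∃-syntax; _×_; _,_)
open import Data.Sum using (_⊎_)
open import Relation.Nullary using (¬_)
open import Relation.Binary.PropositionalEquality using (_≡_; _≢_)
open import Function.Bundles using (_⇔_)

S : ℕ → Set
S n = Permutation′ n

iter : ∀ {n} → S n → ℕ → Fin n → Fin n
iter σ zero x = x
iter σ (suc k) x = σ ⟨$⟩ʳ (iter σ k x)

InOrbit : ∀ {n} → S n → Fin n → Fin n → Set
InOrbit σ x y = ∃[ k ] iter σ k x ≡ y

OrbitLength : ∀ {n} → S n → Fin n → ℕ → Set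
OrbitLength σ x ℓ =
  (1 ≤ ℓ) × (iter σ ℓ x ≡ x) × (∀ k → 1 ≤ k → k < ℓ → iter σ k x ≢ x)

-- A cycle is represented as a partial map on Fin n: defined exactly on its
-- support, where it acts as the cyclic map.  (So a 1-cycle (x) is the map
-- sending x to x and undefined elsewhere.)
Cycle : ℕ → Set
Cycle n = Fin n → Maybe (Fin n)

_≗c_ : ∀ {n} → Cycle n → Cycle n → Set
c ≗c d = ∀ y → c y ≡ d y

IsInverseCycle : ∀ {n} → Cycle n → Cycle n → Set
IsInverseCycle c d = ∀ y z → (c y ≡ just z) ⇔ (d z ≡ just y)

-- c is an ℓ-cycle of σ, i.e. c ∈ C_ℓ(σ) (ℓ = 1 gives fixed points)
IsCycle : ∀ {n} → ℕ → S n → Cycle n → Set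
IsCycle ℓ σ c = ∃[ x ] OrbitLength σ x ℓ ×
  (∀ y → (InOrbit σ x y → c y ≡ just (σ ⟨$⟩ʳ y)) × (¬ InOrbit σ x y → c y ≡ nothing))

IsCycleOf : ∀ {n} → S n → Cycle n → Set
IsCycleOf σ c = ∃[ ℓ ] IsCycle ℓ σ c

_≤c_ : ∀ {n} → S n → S n → Set
τ ≤c σ = ∀ k → 2 ≤ k → ∀ c → IsCycle k τ c → IsCycle k σ c

_∼c_ : ∀ {n} → S n → S n → Set
σ ∼c τ =
  (∀ c → IsCycleOf σ c → ∃[ d ] IsCycleOf τ d × (c ≗c d ⊎ IsInverseCycle c d)) ×
  (∀ d → IsCycleOf τ d → ∃[ c ] IsCycleOf σ c × (d ≗c c ⊎ IsInverseCycle d c))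

-- [τ] ≤[c] [σ], expressed on representatives
_≤[c]_ : ∀ {n} → S n → S n → Set
τ ≤[c] σ = ∃[ τ' ] ∃[ σ' ] (τ' ∼c τ) × (σ' ∼c σ) × (τ' ≤c σ')

{-# OPTIONS --safe #-}
-- τ ≤c σ holds exactly when σ agrees with τ on the points that τ moves; σ τ⁻¹ then fixes
-- those points, and the cycles of σ are those of τ together with those of σ τ⁻¹.
-- Cycle equivalence preserves fixed points, so for τ' ∼c τ the permutation σ' = σ τ⁻¹ τ'
-- still satisfies τ' ≤c σ', and its cycles match those of σ one by one (through τ' ∼c τ on
-- the points τ moves, literally elsewhere), i.e. σ' ∼c σ.  This lifting property is (ii) and
-- yields transitivity of ≤[c].  For antisymmetry, τ₀ ≤c σ₀ ≤c τ₁ with τ₀ ∼c τ₁ forces σ₀ to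
-- fix every point fixed by τ₀, hence σ₀ ∼c τ₀.
module Submission where

open import Defs
open import Data.Nat using (ℕ)
open import Data.Product using (∃-syntax; _×_)
open import Relation.Binary.Structures using (IsPartialOrder)

open import Data.Fin using (Fin; toℕ; _≟_)
open import Data.Fin.Permutation using (_⟨$⟩ʳ_; _⟨$⟩ˡ_; inverseˡ; inverseʳ; flip; _∘ₚ_)
open import Data.Fin.Properties using (pigeonhole)
open import Data.Maybe using (just; nothing)
open import Data.Maybe.Properties using (just-injective)
open import Data.Nat using (zero; suc; _+_; _∸_; _≤_; _<_; _≤?_; z≤n; s≤s)
open import Data.Nat.Induction using (<-wellFounded)
open import Data.Nat.Properties using (n<1+n; <⇒≤; <⇒≱; m<n⇒0<n∸m; m+[n∸m]≡n; m≤n⇒m<n∨m≡n; anyUpTo?)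
open import Data.Product using (_,_; proj₁; proj₂)
open import Data.Sum using (_⊎_; inj₁; inj₂; [_,_]′; reduce)
open import Function using (_∘_)
open import Function.Bundles using (mk⇔; Equivalence; Injection)
open import Function.Construct.Composition using (_⇔-∘_)
open import Function.Properties.Inverse using (↔⇒↣)
open import Induction.WellFounded using (Acc; acc)
open import Relation.Binary.PropositionalEquality using (_≡_; _≢_; refl; sym; trans; cong; subst; module ≡-Reasoning)
open import Relation.Binary.Structures using (IsEquivalence)
open import Relation.Nullary using (¬_; yes; no; contradiction)
open import Relation.Nullary.Decidable using (_×-dec_)
open import Relation.Unary using (Decidable)

private
  variable
    n ℓ ℓ' : ℕ
    σ ρ π τ τ' : S n
    c d e : Cycle n
    x y z : Fin n
    P : Fin n → Set

Fixed : S n → Fin n → Set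
Fixed σ y = σ ⟨$⟩ʳ y ≡ y

Moved : S n → Fin n → Set
Moved σ y = ¬ Fixed σ y

fixed? : (σ : S n) → Decidable (Fixed σ)
fixed? σ y = σ ⟨$⟩ʳ y ≟ y

Invariant : S n → (Fin n → Set) → Set
Invariant σ P = ∀ {y} → P y → P (σ ⟨$⟩ʳ y)

AgreeOn : (Fin n → Set) → S n → S n → Set
AgreeOn P σ ρ = ∀ {y} → P y → σ ⟨$⟩ʳ y ≡ ρ ⟨$⟩ʳ y

⟨$⟩ʳ-injective : (σ : S n) → σ ⟨$⟩ʳ x ≡ σ ⟨$⟩ʳ y → x ≡ y
⟨$⟩ʳ-injective σ = Injection.injective (↔⇒↣ σ)

Fixed-invariant : (σ : S n) → Invariant σ (Fixed σ)
Fixed-invariant σ = cong (σ ⟨$⟩ʳ_)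

Moved-invariant : (σ : S n) → Invariant σ (Moved σ)
Moved-invariant σ moved fixed = moved (⟨$⟩ʳ-injective σ fixed)

Moved-inverse : (σ : S n) → Moved σ y → Moved σ (σ ⟨$⟩ˡ y)
Moved-inverse σ moved = subst (Moved σ) (sym (inverseʳ σ)) moved ∘ Fixed-invariant σ

Fixed-inverse : (σ : S n) → Fixed σ y → σ ⟨$⟩ˡ y ≡ y
Fixed-inverse σ fixed = trans (cong (σ ⟨$⟩ˡ_) (sym fixed)) (inverseˡ σ)

iter-+ : (σ : S n) (i j : ℕ) (x : Fin n) → iter σ (i + j) x ≡ iter σ i (iter σ j x)
iter-+ σ zero    j x = refl
iter-+ σ (suc i) j x = cong (σ ⟨$⟩ʳ_) (iter-+ σ i j x)

iter-injective : ∀ i → iter σ i x ≡ iter σ i y → x ≡ y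
iter-injective         zero    eq = eq
iter-injective {σ = σ} (suc i) eq = iter-injective i (⟨$⟩ʳ-injective σ eq)

iter-Fixed : Fixed σ x → ∀ k → iter σ k x ≡ x
iter-Fixed         fixed zero    = refl
iter-Fixed {σ = σ} fixed (suc k) = trans (cong (σ ⟨$⟩ʳ_) (iter-Fixed fixed k)) fixed

period : (σ : S n) (x : Fin n) → ∃[ p ] 1 ≤ p × iter σ p x ≡ x
period {n} σ x = toℕ j ∸ toℕ i , m<n⇒0<n∸m i<j , iter-injective (toℕ i) returns
  where
  open ≡-Reasoning
  collision = pigeonhole (n<1+n n) (λ i → iter σ (toℕ i) x)
  i = proj₁ collision
  j = proj₁ (proj₂ collision)
  i<j = proj₁ (proj₂ (proj₂ collision))
  returns : iter σ (toℕ i) (iter σ (toℕ j ∸ toℕ i) x) ≡ iter σ (toℕ i) x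
  returns = begin
    iter σ (toℕ i) (iter σ (toℕ j ∸ toℕ i) x) ≡⟨ iter-+ σ (toℕ i) _ x ⟨
    iter σ (toℕ i + (toℕ j ∸ toℕ i)) x        ≡⟨ cong (λ k → iter σ k x) (m+[n∸m]≡n (<⇒≤ i<j)) ⟩
    iter σ (toℕ j) x                          ≡⟨ proj₂ (proj₂ (proj₂ collision)) ⟨
    iter σ (toℕ i) x                          ∎

minimalPeriod : ∀ p → Acc _<_ p → 1 ≤ p → iter σ p x ≡ x → ∃[ ℓ ] OrbitLength σ x ℓ
minimalPeriod {σ = σ} {x = x} p (acc smaller) 1≤p returns
  with anyUpTo? (λ k → (1 ≤? k) ×-dec (iter σ k x ≟ x)) p
... | yes (k , k<p , 1≤k , returnsₖ) = minimalPeriod k (smaller k<p) 1≤k returnsₖ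
... | no noEarlier = p , 1≤p , returns , λ k 1≤k k<p returnsₖ → noEarlier (k , k<p , 1≤k , returnsₖ)

orbitLength : (σ : S n) (x : Fin n) → ∃[ ℓ ] OrbitLength σ x ℓ
orbitLength σ x with p , 1≤p , returns ← period σ x = minimalPeriod p (<-wellFounded p) 1≤p returns

OrbitLength-reduce : OrbitLength σ x ℓ → ∀ k → ∃[ r ] r < ℓ × iter σ r x ≡ iter σ k x
OrbitLength-reduce         (1≤ℓ , _ , _) zero = zero , 1≤ℓ , refl
OrbitLength-reduce {σ = σ} ol@(1≤ℓ , returns , _) (suc k)
  with r , r<ℓ , same ← OrbitLength-reduce ol k
  with m≤n⇒m<n∨m≡n r<ℓ
... | inj₁ 1+r<ℓ = suc r , 1+r<ℓ , cong (σ ⟨$⟩ʳ_) same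
... | inj₂ refl  = zero , 1≤ℓ , trans (sym returns) (cong (σ ⟨$⟩ʳ_) same)

inOrbit? : OrbitLength σ x ℓ → Decidable (InOrbit σ x)
inOrbit? {σ = σ} {x = x} {ℓ = ℓ} ol y with anyUpTo? (λ r → iter σ r x ≟ y) ℓ
... | yes (r , _ , hit) = yes (r , hit)
... | no miss = no λ (k , hit) →
  let r , r<ℓ , same = OrbitLength-reduce ol k in miss (r , r<ℓ , trans same hit)

OrbitLength-Fixed : Fixed σ x → OrbitLength σ x 1
OrbitLength-Fixed fixed = s≤s z≤n , fixed , λ k 1≤k k<1 _ → <⇒≱ k<1 1≤k

OrbitLength-Moved⇒2≤ : OrbitLength σ x ℓ → Moved σ x → 2 ≤ ℓ
OrbitLength-Moved⇒2≤ {ℓ = suc zero}    (_ , returns , _) moved = contradiction returns moved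
OrbitLength-Moved⇒2≤ {ℓ = suc (suc _)} _                 _     = s≤s (s≤s z≤n)

OrbitLength-2≤⇒Moved : OrbitLength σ x ℓ → 2 ≤ ℓ → Moved σ x
OrbitLength-2≤⇒Moved (_ , _ , minimal) 2≤ℓ = minimal 1 (s≤s z≤n) 2≤ℓ

orbitCycle : {σ : S n} → OrbitLength σ x ℓ → Cycle n
orbitCycle {σ = σ} ol y with inOrbit? ol y
... | yes _ = just (σ ⟨$⟩ʳ y)
... | no  _ = nothing

orbitCycle-isCycle : (ol : OrbitLength σ x ℓ) → IsCycle ℓ σ (orbitCycle ol)
orbitCycle-isCycle {σ = σ} {x = x} ol = x , ol , λ y → inside y , outside y
  where
  inside : ∀ y → InOrbit σ x y → orbitCycle ol y ≡ just (σ ⟨$⟩ʳ y)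
  inside y o with inOrbit? ol y
  ... | yes _ = refl
  ... | no ¬o = contradiction o ¬o
  outside : ∀ y → ¬ InOrbit σ x y → orbitCycle ol y ≡ nothing
  outside y ¬o with inOrbit? ol y
  ... | yes o = contradiction o ¬o
  ... | no _  = refl

base : {σ : S n} → IsCycle ℓ σ c → Fin n
base = proj₁

IsCycle-base : (cy : IsCycle ℓ σ c) → c (base cy) ≡ just (σ ⟨$⟩ʳ base cy)
IsCycle-base (x , _ , support) = proj₁ (support x) (0 , refl)

IsCycle-support : (cy : IsCycle ℓ σ c) → c y ≡ just z → InOrbit σ (base cy) y
IsCycle-support {y = y} (x , ol , support) cy≡ with inOrbit? ol y
... | yes o = o
... | no ¬o = contradiction (trans (sym cy≡) (proj₂ (support y) ¬o)) λ ()

IsCycle-just : IsCycle ℓ σ c → c y ≡ just z → z ≡ σ ⟨$⟩ʳ y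
IsCycle-just {y = y} cy cy≡ =
  just-injective (trans (sym cy≡) (proj₁ (proj₂ (proj₂ cy) y) (IsCycle-support cy cy≡)))

IsCycle-Moved : (cy : IsCycle ℓ σ c) → c y ≡ just z → y ≢ z → Moved σ (base cy)
IsCycle-Moved {σ = σ} {y = y} cy cy≡ y≢z fixed = y≢z (trans y≡x (sym z≡x))
  where
  k = proj₁ (IsCycle-support cy cy≡)
  y≡x : y ≡ base cy
  y≡x = trans (sym (proj₂ (IsCycle-support cy cy≡))) (iter-Fixed fixed k)
  z≡x = trans (IsCycle-just cy cy≡) (trans (cong (σ ⟨$⟩ʳ_) y≡x) fixed)

IsCycle-transport : Invariant σ P → AgreeOn P σ ρ →
                    (cy : IsCycle ℓ σ c) → P (base cy) → IsCycle ℓ ρ c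
IsCycle-transport {σ = σ} {P = P} {ρ = ρ} {ℓ = ℓ} {c = c}
                  inv agree (x , (1≤ℓ , returns , minimal) , support) Px =
  x , (1≤ℓ , trans (same ℓ) returns , λ k 1≤k k<ℓ → minimal k 1≤k k<ℓ ∘ trans (sym (same k))) ,
  λ y → inside y , outside y
  where
  orbit-P : ∀ k → P (iter σ k x)
  orbit-P zero    = Px
  orbit-P (suc k) = inv (orbit-P k)
  same : ∀ k → iter ρ k x ≡ iter σ k x
  same zero    = refl
  same (suc k) = trans (cong (ρ ⟨$⟩ʳ_) (same k)) (sym (agree (orbit-P k)))
  inside : ∀ y → InOrbit ρ x y → c y ≡ just (ρ ⟨$⟩ʳ y)
  inside y (k , hit) =
    trans (proj₁ (support y) (k , hitσ)) (cong just (agree (subst P hitσ (orbit-P k))))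
    where hitσ = trans (sym (same k)) hit
  outside : ∀ y → ¬ InOrbit ρ x y → c y ≡ nothing
  outside y ¬o = proj₂ (support y) λ (k , hit) → ¬o (k , trans (same k) hit)

EqualOrInverse : Cycle n → Cycle n → Set
EqualOrInverse c d = c ≗c d ⊎ IsInverseCycle c d

IsInverseCycle-congˡ : c ≗c d → IsInverseCycle c e → IsInverseCycle d e
IsInverseCycle-congˡ c≗d inv y z = inv y z ⇔-∘ mk⇔ (trans (c≗d y)) (trans (sym (c≗d y)))

IsInverseCycle-congʳ : d ≗c e → IsInverseCycle c d → IsInverseCycle c e
IsInverseCycle-congʳ d≗e inv y z = mk⇔ (trans (sym (d≗e z))) (trans (d≗e z)) ⇔-∘ inv y z

IsInverseCycle-involutive : IsInverseCycle c d → IsInverseCycle d e → c ≗c e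
IsInverseCycle-involutive {c = c} {e = e} c⁻¹d d⁻¹e y with c y in cy≡ | e y in ey≡
... | just z  | _       = trans (sym (Equivalence.to (d⁻¹e z y) (Equivalence.to (c⁻¹d y z) cy≡))) ey≡
... | nothing | nothing = refl
... | nothing | just z
  with () ← trans (sym cy≡) (Equivalence.from (c⁻¹d y z) (Equivalence.from (d⁻¹e z y) ey≡))

EqualOrInverse-refl : EqualOrInverse c c
EqualOrInverse-refl = inj₁ λ _ → refl

EqualOrInverse-trans : EqualOrInverse c d → EqualOrInverse d e → EqualOrInverse c e
EqualOrInverse-trans (inj₁ c≗d) (inj₁ d≗e) = inj₁ λ y → trans (c≗d y) (d≗e y)
EqualOrInverse-trans (inj₁ c≗d) (inj₂ inv) = inj₂ (IsInverseCycle-congˡ (sym ∘ c≗d) inv)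
EqualOrInverse-trans (inj₂ inv) (inj₁ d≗e) = inj₂ (IsInverseCycle-congʳ d≗e inv)
EqualOrInverse-trans (inj₂ inv) (inj₂ inv') = inj₁ (IsInverseCycle-involutive inv inv')

EqualOrInverse-just : EqualOrInverse c d → c y ≡ just z → d y ≡ just z ⊎ d z ≡ just y
EqualOrInverse-just {y = y} (inj₁ c≗d) cy≡ = inj₁ (trans (sym (c≗d y)) cy≡)
EqualOrInverse-just {y = y} {z} (inj₂ inv) cy≡ = inj₂ (Equivalence.to (inv y z) cy≡)

EqualOrInverse-Moved : EqualOrInverse c d → (cy : IsCycle ℓ σ c) (cyd : IsCycle ℓ' ρ d) →
                       Moved σ (base cy) → Moved ρ (base cyd)
EqualOrInverse-Moved c≈d cy cyd moved =
  [ (λ dx≡ → IsCycle-Moved cyd dx≡ x≢σx) , (λ dσx≡ → IsCycle-Moved cyd dσx≡ (x≢σx ∘ sym)) ]′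
    (EqualOrInverse-just c≈d (IsCycle-base cy))
  where x≢σx = moved ∘ sym

∼c-refl : σ ∼c σ
∼c-refl = (λ c cy → c , cy , EqualOrInverse-refl) , (λ c cy → c , cy , EqualOrInverse-refl)

∼c-sym : σ ∼c ρ → ρ ∼c σ
∼c-sym (forth , back) = back , forth

∼c-trans : σ ∼c π → π ∼c ρ → σ ∼c ρ
∼c-trans (forth₁ , back₁) (forth₂ , back₂) = compose forth₁ forth₂ , compose back₂ back₁
  where
  compose : ∀ {α β γ : S _} →
            (∀ c → IsCycleOf α c → ∃[ d ] IsCycleOf β d × EqualOrInverse c d) →
            (∀ d → IsCycleOf β d → ∃[ e ] IsCycleOf γ e × EqualOrInverse d e) →
            (∀ c → IsCycleOf α c → ∃[ e ] IsCycleOf γ e × EqualOrInverse c e)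
  compose f g c cy with d , dy , c≈d ← f c cy with e , ey , d≈e ← g d dy =
    e , ey , EqualOrInverse-trans c≈d d≈e

∼c-isEquivalence : IsEquivalence (_∼c_ {n})
∼c-isEquivalence = record { refl = ∼c-refl ; sym = ∼c-sym ; trans = ∼c-trans }

∼c-Fixed : σ ∼c ρ → Fixed σ y → Fixed ρ y
∼c-Fixed {σ = σ} (forth , _) fixed =
  let _ , (_ , cyd) , c≈d = forth _ (1 , fixedCycle)
  in sym (IsCycle-just cyd (reduce (EqualOrInverse-just c≈d y↦y)))
  where
  fixedCycle = orbitCycle-isCycle (OrbitLength-Fixed {σ = σ} fixed)
  y↦y = trans (IsCycle-base fixedCycle) (cong just fixed)

∼c-Moved : σ ∼c ρ → Moved σ y → Moved ρ y
∼c-Moved σ∼ρ moved = moved ∘ ∼c-Fixed (∼c-sym σ∼ρ)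

≤c-refl : σ ≤c σ
≤c-refl _ _ _ cy = cy

≤c-trans : τ ≤c σ → σ ≤c ρ → τ ≤c ρ
≤c-trans τ≤σ σ≤ρ k 2≤k c = σ≤ρ k 2≤k c ∘ τ≤σ k 2≤k c

≤c⇒AgreeOnMoved : τ ≤c σ → AgreeOn (Moved τ) σ τ
≤c⇒AgreeOnMoved {τ = τ} τ≤σ {y} moved with ℓ , ol ← orbitLength τ y =
  sym (IsCycle-just (τ≤σ ℓ (OrbitLength-Moved⇒2≤ ol moved) _ (orbitCycle-isCycle ol))
                    (IsCycle-base (orbitCycle-isCycle ol)))

AgreeOnMoved⇒≤c : AgreeOn (Moved τ) σ τ → τ ≤c σ
AgreeOnMoved⇒≤c {τ = τ} agree k 2≤k c cy =
  IsCycle-transport (Moved-invariant τ) (λ moved → sym (agree moved)) cy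
                    (OrbitLength-2≤⇒Moved (proj₁ (proj₂ cy)) 2≤k)

≤c⇒Fixed : τ ≤c σ → Fixed σ y → Fixed τ y
≤c⇒Fixed {τ = τ} {y = y} τ≤σ fixed with fixed? τ y
... | yes fixed' = fixed'
... | no moved   = contradiction (trans (sym (≤c⇒AgreeOnMoved τ≤σ moved)) fixed) moved

≤c⇒Moved-invariant : τ ≤c σ → Invariant σ (Moved τ)
≤c⇒Moved-invariant {τ = τ} τ≤σ moved =
  subst (Moved τ) (sym (≤c⇒AgreeOnMoved τ≤σ moved)) (Moved-invariant τ moved)

≤c⇒Moved-reflect : τ ≤c σ → Moved τ (σ ⟨$⟩ʳ y) → Moved τ y
≤c⇒Moved-reflect {τ = τ} {σ = σ} τ≤σ moved = subst (Moved τ) u≡y u-moved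
  where
  u-moved = Moved-inverse τ moved
  u≡y = ⟨$⟩ʳ-injective σ (trans (≤c⇒AgreeOnMoved τ≤σ u-moved) (inverseʳ τ))

≤c⇒Fixed-invariant : τ ≤c σ → Invariant σ (Fixed τ)
≤c⇒Fixed-invariant {τ = τ} {σ = σ} τ≤σ {y} fixed with fixed? τ (σ ⟨$⟩ʳ y)
... | yes fixed' = fixed'
... | no moved   = contradiction fixed (≤c⇒Moved-reflect τ≤σ moved)

nontrivialCycle-match : {σ' : S n} → τ ∼c τ' → τ' ≤c σ' →
                        (cy : IsCycle ℓ τ c) → Moved τ (base cy) →
                        ∃[ d ] IsCycleOf σ' d × EqualOrInverse c d
nontrivialCycle-match (forth , _) τ'≤σ' cy moved
  with d , (ℓ' , cyd) , c≈d ← forth _ (_ , cy) =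
  d , (ℓ' , τ'≤σ' ℓ' 2≤ℓ' d cyd) , c≈d
  where 2≤ℓ' = OrbitLength-Moved⇒2≤ (proj₁ (proj₂ cyd)) (EqualOrInverse-Moved c≈d cy cyd moved)

extensionCycle-match : {σ' : S n} → τ ≤c σ → τ' ≤c σ' → τ ∼c τ' → AgreeOn (Fixed τ) σ σ' →
                       ∀ c → IsCycleOf σ c → ∃[ d ] IsCycleOf σ' d × EqualOrInverse c d
extensionCycle-match {τ = τ} τ≤σ τ'≤σ' τ∼τ' agree c (ℓ , cy) with fixed? τ (base cy)
... | yes fixed =
  c , (ℓ , IsCycle-transport (≤c⇒Fixed-invariant τ≤σ) agree cy fixed) , EqualOrInverse-refl
... | no moved =
  nontrivialCycle-match τ∼τ' τ'≤σ'
    (IsCycle-transport (≤c⇒Moved-invariant τ≤σ) (≤c⇒AgreeOnMoved τ≤σ) cy moved) moved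

∼c-extensions : {σ' : S n} → τ ≤c σ → τ' ≤c σ' → τ ∼c τ' → AgreeOn (Fixed τ) σ σ' → σ ∼c σ'
∼c-extensions τ≤σ τ'≤σ' τ∼τ' agree =
  extensionCycle-match τ≤σ τ'≤σ' τ∼τ' agree ,
  extensionCycle-match τ'≤σ' τ≤σ τ'∼τ (λ fixed → sym (agree (∼c-Fixed τ'∼τ fixed)))
  where τ'∼τ = ∼c-sym τ∼τ'

≤c-lift : τ ≤c σ → τ' ∼c τ → ∃[ σ' ] σ' ∼c σ × τ' ≤c σ'
≤c-lift {τ = τ} {σ = σ} {τ' = τ'} τ≤σ τ'∼τ =
  σ' , ∼c-extensions τ'≤σ' τ≤σ τ'∼τ fixed-agree , τ'≤σ'
  where
  -- σ τ⁻¹ τ' : _∘ₚ_ composes left to right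
  σ' = τ' ∘ₚ flip τ ∘ₚ σ
  τ'≤σ' : τ' ≤c σ'
  τ'≤σ' = AgreeOnMoved⇒≤c λ moved →
    trans (≤c⇒AgreeOnMoved τ≤σ (Moved-inverse τ (∼c-Moved τ'∼τ (Moved-invariant τ' moved))))
          (inverseʳ τ)
  fixed-agree : AgreeOn (Fixed τ') σ' σ
  fixed-agree fixed =
    cong (σ ⟨$⟩ʳ_) (trans (cong (τ ⟨$⟩ˡ_) fixed) (Fixed-inverse τ (∼c-Fixed τ'∼τ fixed)))

≤[c]-lift : τ ≤[c] σ → τ' ∼c τ → ∃[ σ' ] σ' ∼c σ × τ' ≤c σ'
≤[c]-lift (τ₀ , σ₀ , τ₀∼τ , σ₀∼σ , τ₀≤σ₀) τ'∼τ =
  let σ' , σ'∼σ₀ , τ'≤σ' = ≤c-lift τ₀≤σ₀ (∼c-trans τ'∼τ (∼c-sym τ₀∼τ)) in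
  σ' , ∼c-trans σ'∼σ₀ σ₀∼σ , τ'≤σ'

≤[c]-reflexive : τ ∼c σ → τ ≤[c] σ
≤[c]-reflexive {τ = τ} τ∼σ = τ , τ , ∼c-refl , τ∼σ , ≤c-refl

≤[c]-trans : τ ≤[c] σ → σ ≤[c] ρ → τ ≤[c] ρ
≤[c]-trans (τ₀ , σ₀ , τ₀∼τ , σ₀∼σ , τ₀≤σ₀) σ≤ρ =
  let ρ' , ρ'∼ρ , σ₀≤ρ' = ≤[c]-lift σ≤ρ σ₀∼σ in
  τ₀ , ρ' , τ₀∼τ , ρ'∼ρ , ≤c-trans τ₀≤σ₀ σ₀≤ρ'

≤c-sandwich : τ ≤c σ → σ ≤c ρ → τ ∼c ρ → σ ∼c τ
≤c-sandwich {τ = τ} {σ = σ} τ≤σ σ≤ρ τ∼ρ = ∼c-extensions τ≤σ ≤c-refl ∼c-refl σ-fixes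
  where
  σ-fixes : AgreeOn (Fixed τ) σ τ
  σ-fixes fixed = trans (≤c⇒Fixed σ≤ρ (∼c-Fixed τ∼ρ fixed)) (sym fixed)

≤[c]-antisym : τ ≤[c] σ → σ ≤[c] τ → τ ∼c σ
≤[c]-antisym (τ₀ , σ₀ , τ₀∼τ , σ₀∼σ , τ₀≤σ₀) σ≤τ =
  let τ₁ , τ₁∼τ , σ₀≤τ₁ = ≤[c]-lift σ≤τ σ₀∼σ
      σ₀∼τ₀ = ≤c-sandwich τ₀≤σ₀ σ₀≤τ₁ (∼c-trans τ₀∼τ (∼c-sym τ₁∼τ))
  in ∼c-trans (∼c-sym τ₀∼τ) (∼c-trans (∼c-sym σ₀∼τ₀) σ₀∼σ)

≤[c]-isPartialOrder : IsPartialOrder (_∼c_ {n}) _≤[c]_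
≤[c]-isPartialOrder = record
  { isPreorder = record
    { isEquivalence = ∼c-isEquivalence
    ; reflexive     = ≤[c]-reflexive
    ; trans         = ≤[c]-trans
    }
  ; antisym = ≤[c]-antisym
  }

proposition4p8 : (n : ℕ) →
    IsPartialOrder (_∼c_ {n}) (_≤[c]_ {n}) ×
    (∀ (τ σ : S n) → τ ≤[c] σ → ∀ (τ' : S n) → τ' ∼c τ →
      ∃[ σ' ] (σ' ∼c σ) × (τ' ≤c σ'))
proposition4p8 n = ≤[c]-isPartialOrder , λ τ σ τ≤σ τ' τ'∼τ → ≤[c]-lift τ≤σ τ'∼τ
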